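{- Let $f:\{0,1\}^n\to\{0,1\}$ be a non-constant function and let $d=\deg_2(f)\ge1$ be its $\mathrm{GF}(2)$-degree. Then $\mathrm{gran}(f^{\pm})\le n-\lceil n/d\rceil$, and consequently $\mathrm{gran}(f)\le n-\lceil n/d\rceil+1$.
   Context: $f^{\pm}=1-2f$. For $h:\{0,1\}^n\to\mathbb{R}$, $\hat h(S)=2^{ -n}\sum_x h(x)(-1)^{\sum_{i\in S}x_i}$. A nonzero rational $r$ has granularity $\mathrm{gran}(r)=k$ if $r=m/2^k$ for some odd integer $m$; the Fourier granularity $\mathrm{gran}(h)$ of a function $h$ is the maximum of $\mathrm{gran}(\hat h(S))$ over all $S$ with $\hat h(S)\ne0$. -}

module Defs where

open import Data.Bool using (Bool; true; false; _∧_; _xor_; if_then_else_)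
open import Data.Nat as ℕ using (ℕ; zero; suc)
open import Data.Integer as ℤ using (ℤ; +_; -[1+_])
open import Data.Rational as ℚ using (ℚ; 0ℚ; 1ℚ; ½)
open import Data.List using (List; []; _∷_; map; _++_; foldr)
open import Data.Vec using (Vec; []; _∷_; zipWith; foldr′)
open import Data.Product using (Σ; _×_; _,_)
open import Relation.Binary.PropositionalEquality using (_≡_; _≢_)

-- Boolean cube {0,1}^n, points encoded as Vec Bool n (true = 1).
Cube : ℕ → Set
Cube n = Vec Bool n

allPoints : (n : ℕ) → List (Cube n)
allPoints zero    = [] ∷ []
allPoints (suc n) = map (false ∷_) (allPoints n) ++ map (true ∷_) (allPoints n)

-- Subsets S ⊆ [n] are encoded by their indicator vectors.
-- Cardinality of a subset.
card : ∀ {n} → Vec Bool n → ℕ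
card = foldr′ (λ b k → if b then suc k else k) 0

_⊆ᵇ_ : ∀ {n} → Vec Bool n → Vec Bool n → Bool
[] ⊆ᵇ [] = true
(false ∷ s) ⊆ᵇ (_ ∷ t) = s ⊆ᵇ t
(true ∷ s) ⊆ᵇ (b ∷ t) = b ∧ (s ⊆ᵇ t)

xorSum : List Bool → Bool
xorSum = foldr _xor_ false

-- Evaluation at x of the multilinear GF(2) polynomial Σ_S a_S Π_{i∈S} x_i;
-- the monomial Π_{i∈S} x_i equals 1 iff S ⊆ x.
evalANF : ∀ {n} → (Cube n → Bool) → Cube n → Bool
evalANF {n} a x = xorSum (map (λ S → a S ∧ (S ⊆ᵇ x)) (allPoints n))

-- deg₂ f ≡ d : f is represented by the (unique) multilinear GF(2)
-- polynomial with coefficients a, and d is the max |S| with a_S = 1.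
IsDeg2 : ∀ {n} → (Cube n → Bool) → ℕ → Set
IsDeg2 {n} f d =
  Σ (Cube n → Bool) λ a →
    ((x : Cube n) → f x ≡ evalANF a x)
    × Σ (Cube n) (λ S → (a S ≡ true) × (card S ≡ d))
    × ((S : Cube n) → a S ≡ true → card S ℕ.≤ d)

NonConstant : ∀ {n} → (Cube n → Bool) → Set
NonConstant {n} f = Σ (Cube n) λ x → Σ (Cube n) λ y → f x ≢ f y

toℚ : Bool → ℚ
toℚ true  = 1ℚ
toℚ false = 0ℚ

pm : ∀ {n} → (Cube n → Bool) → Cube n → ℚ
pm f x = 1ℚ ℚ.- (+ 2 ℚ./ 1) ℚ.* toℚ (f x)

chi : ∀ {n} → Vec Bool n → Cube n → ℚ
chi S x = if xorSum (Data.Vec.toList (zipWith _∧_ S x)) then ℚ.- 1ℚ else 1ℚ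
  where import Data.Vec

sumℚ : List ℚ → ℚ
sumℚ = foldr ℚ._+_ 0ℚ

halfPow : ℕ → ℚ
halfPow zero    = 1ℚ
halfPow (suc k) = ½ ℚ.* halfPow k

twoPow : ℕ → ℚ
twoPow zero    = 1ℚ
twoPow (suc k) = (+ 2 ℚ./ 1) ℚ.* twoPow k

pow2neg : ℤ → ℚ
pow2neg (+ k)      = halfPow k
pow2neg -[1+ k ]   = twoPow (suc k)

fourier : ∀ {n} → (Cube n → ℚ) → Vec Bool n → ℚ
fourier {n} h S = halfPow n ℚ.* sumℚ (map (λ x → h x ℚ.* chi S x) (allPoints n))

Odd : ℤ → Set
Odd m = Σ ℤ λ t → m ≡ (+ 2) ℤ.* t ℤ.+ + 1

GranIs : ℚ → ℤ → Set
GranIs r k = Σ ℤ λ m → Odd m × (r ≡ (m ℚ./ 1) ℚ.* pow2neg k)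

FourierGranIs : ∀ {n} → (Cube n → ℚ) → ℤ → Set
FourierGranIs {n} h g =
  Σ (Vec Bool n) (λ S → (fourier h S ≢ 0ℚ) × GranIs (fourier h S) g)
  × ((S : Vec Bool n) (k : ℤ) → fourier h S ≢ 0ℚ → GranIs (fourier h S) k → k ℤ.≤ g)

module Submission where

-- Write f = Σ_T a_T x^T over GF(2) with every |T| ≤ d.  Over the integers
--   (-1)^f = Π_T (1 - 2 a_T x^T)   and   2f = 1 - (-1)^f.
-- Every integer-valued h on the cube has a unique multilinear expansion
-- h = Σ_D c_D x^D over ℤ; call h graded at level s if each c_D is divisible by
-- 2^k for some k with k·d ≥ s + |D|.  Graded functions are closed under sums,
-- negation and products (levels add, by the Leibniz rule for differences);
-- the factors 1 - 2 x^T (|T| ≤ d) and the characters (-1)^{S·x} are graded at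
-- level 0, hence so are (-1)^f·χ_S and 2f·χ_S.  Summing a level-s function over
-- {0,1}^n gives an integer at level n + s, because Σ_x x^D = 2^{n-|D|}.  So
-- 2^n·\hat{f^±}(S) is divisible by 2^⌈n/d⌉, and 2^{n+1}·\hat f(S) likewise,
-- which bounds the granularities by n - ⌈n/d⌉ and n + 1 - ⌈n/d⌉.

open import Defs
open import Data.Bool using (Bool; true; false; _∧_; _xor_; not; if_then_else_)
open import Data.Nat as ℕ using (ℕ; zero; suc; NonZero)
import Data.Nat.Properties as ℕP
import Data.Nat.GCD as ℕGCD
open import Data.Integer as ℤ
  using (ℤ; +_; -[1+_]; 0ℤ; 1ℤ; _+_; _-_; -_; _*_; _≤_; _<_)
import Data.Integer.Properties as ℤP
open import Data.Integer.DivMod using (_/ℕ_; div-pos-is-/ℕ; n<s[n/ℕd]*d)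
open import Data.Integer.Divisibility.Signed
  using (_∣_; divides; ∣-trans; ∣m∣n⇒∣m+n; ∣m⇒∣-m; *-monoʳ-∣; *-monoˡ-∣)
open import Data.Integer.Tactic.RingSolver using (solve-∀)
open import Data.Rational as ℚ using (ℚ; mkℚ; 1ℚ; _/_; ceiling; floor; ↥_; ↧_)
import Data.Rational.Properties as ℚP
open import Data.Rational.Literals using (fromℤ)
open import Data.Rational.Solver using (module +-*-Solver)
open import Data.Vec using (Vec; []; _∷_; toList; zipWith)
open import Data.List using (List; []; _∷_; map; _++_)
open import Data.Product using (Σ; _×_; _,_)
open import Data.Sum using (inj₁; inj₂)
open import Data.Empty using (⊥-elim)
open import Relation.Nullary using (yes; no)
open import Relation.Binary.PropositionalEquality

pow2 : ℕ → ℤ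
pow2 k = + (2 ℕ.^ k)

pow2-+ : ∀ a b → pow2 (a ℕ.+ b) ≡ pow2 a * pow2 b
pow2-+ a b = trans (cong +_ (ℕP.^-distribˡ-+-* 2 a b)) (ℤP.pos-* (2 ℕ.^ a) (2 ℕ.^ b))

pow2-∣-mono : ∀ {k l} → k ℕ.≤ l → pow2 k ∣ pow2 l
pow2-∣-mono {k} k≤l with ℕP.m≤n⇒∃[o]m+o≡n k≤l
... | t , refl = divides (pow2 t) (trans (pow2-+ k t) (ℤP.*-comm (pow2 k) (pow2 t)))

pow2-∣-* : ∀ k l {a b} → pow2 k ∣ a → pow2 l ∣ b → pow2 (k ℕ.+ l) ∣ a * b
pow2-∣-* k l {a} k∣a l∣b =
  subst (_∣ _) (sym (pow2-+ k l)) (∣-trans (*-monoˡ-∣ (pow2 l) k∣a) (*-monoʳ-∣ a l∣b))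

even≢odd : ∀ w u → + 2 * w ≢ + 2 * u + 1ℤ
even≢odd w u eq = ℕP.even≢odd ℤ.∣ w - u ∣ 0 (begin
  2 ℕ.* ℤ.∣ w - u ∣      ≡⟨ ℤP.abs-* (+ 2) (w - u) ⟨
  ℤ.∣ + 2 * (w - u) ∣    ≡⟨ cong ℤ.∣_∣ (distrib w u) ⟩
  ℤ.∣ + 2 * w - + 2 * u ∣ ≡⟨ cong (λ z → ℤ.∣ z - + 2 * u ∣) eq ⟩
  ℤ.∣ + 2 * u + 1ℤ - + 2 * u ∣ ≡⟨ cong ℤ.∣_∣ (cancel u) ⟩
  1 ∎)
  where
  open ≡-Reasoning
  distrib : ∀ w u → + 2 * (w - u) ≡ + 2 * w - + 2 * u
  distrib = solve-∀
  cancel : ∀ u → + 2 * u + 1ℤ - + 2 * u ≡ 1ℤ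
  cancel = solve-∀

odd-pow2-bound : ∀ {m} a b → Odd m → pow2 a ∣ m * pow2 b → a ℕ.≤ b
odd-pow2-bound a b _ _ with a ℕ.≤? b
... | yes a≤b = a≤b
... | no a≰b with ℕP.m≤n⇒∃[o]m+o≡n (ℕP.≰⇒> a≰b)
odd-pow2-bound _ b (u , refl) (divides q eq) | no _ | t , refl =
  ⊥-elim (even≢odd (q * pow2 t) u (sym (ℤP.*-cancelʳ-≡ _ _ (pow2 b) {{ℤnz}} shifted)))
  where
  ℤnz : ℤ.NonZero (pow2 b)
  ℤnz = ℕP.m^n≢0 2 b
  regroup : ∀ q x y → q * ((+ 2 * y) * x) ≡ (+ 2 * (q * x)) * y
  regroup = solve-∀
  -- cancelling the common factor 2^b from (2u+1)·2^b = q·2^(b+1+t)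
  shifted : (+ 2 * u + 1ℤ) * pow2 b ≡ (+ 2 * (q * pow2 t)) * pow2 b
  shifted = begin
    (+ 2 * u + 1ℤ) * pow2 b          ≡⟨ eq ⟩
    q * pow2 (suc b ℕ.+ t)           ≡⟨ cong (q *_) (pow2-+ (suc b) t) ⟩
    q * (pow2 (suc b) * pow2 t)      ≡⟨ cong (λ z → q * (z * pow2 t)) (ℤP.pos-* 2 (2 ℕ.^ b)) ⟩
    q * ((+ 2 * pow2 b) * pow2 t)    ≡⟨ regroup q (pow2 t) (pow2 b) ⟩
    (+ 2 * (q * pow2 t)) * pow2 b    ∎
    where open ≡-Reasoning

Σℤ : {A : Set} → List A → (A → ℤ) → ℤ
Σℤ []      h = 0ℤ
Σℤ (x ∷ L) h = h x + Σℤ L h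

cubeSum : (n : ℕ) → (Cube n → ℤ) → ℤ
cubeSum n = Σℤ (allPoints n)

Σ-++ : {A : Set} (L M : List A) (h : A → ℤ) → Σℤ (L ++ M) h ≡ Σℤ L h + Σℤ M h
Σ-++ []      M h = sym (ℤP.+-identityˡ (Σℤ M h))
Σ-++ (x ∷ L) M h = trans (cong (λ z → h x + z) (Σ-++ L M h)) (sym (ℤP.+-assoc (h x) _ _))

Σ-map : {A B : Set} (g : A → B) (L : List A) (h : B → ℤ) → Σℤ (map g L) h ≡ Σℤ L (λ x → h (g x))
Σ-map g []      h = refl
Σ-map g (x ∷ L) h = cong (λ z → h (g x) + z) (Σ-map g L h)

Σ-sub : {A : Set} (L : List A) (h h′ : A → ℤ) → Σℤ L (λ x → h x - h′ x) ≡ Σℤ L h - Σℤ L h′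
Σ-sub []      h h′ = refl
Σ-sub (x ∷ L) h h′ = trans (cong (λ z → h x - h′ x + z) (Σ-sub L h h′)) (interchange (h x) (h′ x) _ _)
  where
  interchange : ∀ a b c e → (a - b) + (c - e) ≡ (a + c) - (b + e)
  interchange = solve-∀

Σ-scale : {A : Set} (L : List A) (c : ℤ) (h : A → ℤ) → Σℤ L (λ x → c * h x) ≡ c * Σℤ L h
Σ-scale []      c h = sym (ℤP.*-zeroʳ c)
Σ-scale (x ∷ L) c h = trans (cong (λ z → c * h x + z) (Σ-scale L c h)) (sym (ℤP.*-distribˡ-+ c (h x) _))

cubeSum-suc : ∀ n h → cubeSum (suc n) h ≡ cubeSum n (λ x → h (false ∷ x)) + cubeSum n (λ x → h (true ∷ x))
cubeSum-suc n h = trans (Σ-++ (map (false ∷_) (allPoints n)) _ h)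
  (cong₂ _+_ (Σ-map (false ∷_) (allPoints n) h) (Σ-map (true ∷_) (allPoints n) h))

sgn : Bool → ℤ
sgn false = 1ℤ
sgn true  = -[1+ 0 ]

bit : Bool → ℤ
bit false = 0ℤ
bit true  = 1ℤ

sgn-xor : ∀ a b → sgn (a xor b) ≡ sgn a * sgn b
sgn-xor false b     = sym (ℤP.*-identityˡ (sgn b))
sgn-xor true  false = refl
sgn-xor true  true  = refl

sgn-not : ∀ b → sgn (not b) - sgn b ≡ - (+ 2 * sgn b)
sgn-not false = refl
sgn-not true  = refl

sgn-bit : ∀ b → sgn b ≡ 1ℤ + - (+ 2 * bit b)
sgn-bit false = refl
sgn-bit true  = refl

-- 2b·c = c - (-1)^b·c: this expresses 2f through f^± = (-1)^f.
two-bit : ∀ b c → + 2 * (bit b * c) ≡ c + - (sgn b * c)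
two-bit false = cancel
  where
  cancel : ∀ c → + 2 * (0ℤ * c) ≡ c + - (1ℤ * c)
  cancel = solve-∀
two-bit true  = double
  where
  double : ∀ c → + 2 * (1ℤ * c) ≡ c + - (-[1+ 0 ] * c)
  double = solve-∀

χ : ∀ {n} → Vec Bool n → Cube n → ℤ
χ S x = sgn (xorSum (toList (zipWith _∧_ S x)))

monomial : ∀ {n} → Vec Bool n → Cube n → ℤ
monomial T x = bit (T ⊆ᵇ x)

fromℤ-/1 : ∀ m → m / 1 ≡ fromℤ m
fromℤ-/1 m = ℚP.↥p/↧p≡p (fromℤ m)

fromℤ-+ : ∀ a b → fromℤ a ℚ.+ fromℤ b ≡ fromℤ (a + b)
fromℤ-+ a b = trans (cong₂ (λ x y → (x + y) / 1) (ℤP.*-identityʳ a) (ℤP.*-identityʳ b)) (fromℤ-/1 _)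

fromℤ-* : ∀ a b → fromℤ a ℚ.* fromℤ b ≡ fromℤ (a * b)
fromℤ-* a b = fromℤ-/1 (a * b)

fromℤ-injective : ∀ {a b} → fromℤ a ≡ fromℤ b → a ≡ b
fromℤ-injective = cong ℚ.numerator

twoPow≡pow2 : ∀ k → twoPow k ≡ fromℤ (pow2 k)
twoPow≡pow2 zero    = refl
twoPow≡pow2 (suc k) = begin
  fromℤ (+ 2) ℚ.* twoPow k         ≡⟨ cong (fromℤ (+ 2) ℚ.*_) (twoPow≡pow2 k) ⟩
  fromℤ (+ 2) ℚ.* fromℤ (pow2 k)   ≡⟨ fromℤ-* (+ 2) (pow2 k) ⟩
  fromℤ (+ 2 * pow2 k)             ≡⟨ cong fromℤ (ℤP.pos-* 2 (2 ℕ.^ k)) ⟨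
  fromℤ (pow2 (suc k))             ∎
  where open ≡-Reasoning

halfPow-inverse : ∀ k → halfPow k ℚ.* twoPow k ≡ 1ℚ
halfPow-inverse zero    = refl
halfPow-inverse (suc k) = trans (interchange ℚ.½ (halfPow k) (fromℤ (+ 2)) (twoPow k))
                                (cong (ℚ.½ ℚ.* fromℤ (+ 2) ℚ.*_) (halfPow-inverse k))
  where
  open +-*-Solver
  interchange : ∀ a b c e → (a ℚ.* b) ℚ.* (c ℚ.* e) ≡ (a ℚ.* c) ℚ.* (b ℚ.* e)
  interchange = solve 4 (λ a b c e → (a :* b) :* (c :* e) := (a :* c) :* (b :* e)) refl

sumℚ-fromℤ : {A : Set} (L : List A) (h : A → ℚ) (hℤ : A → ℤ) → (∀ x → h x ≡ fromℤ (hℤ x)) →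
             sumℚ (map h L) ≡ fromℤ (Σℤ L hℤ)
sumℚ-fromℤ []      h hℤ h≡ = refl
sumℚ-fromℤ (x ∷ L) h hℤ h≡ = trans (cong₂ ℚ._+_ (h≡ x) (sumℚ-fromℤ L h hℤ h≡)) (fromℤ-+ (hℤ x) _)

pm≡sgn : ∀ b → 1ℚ ℚ.- (+ 2 / 1) ℚ.* toℚ b ≡ fromℤ (sgn b)
pm≡sgn false = refl
pm≡sgn true  = refl

toℚ≡bit : ∀ b → toℚ b ≡ fromℤ (bit b)
toℚ≡bit false = refl
toℚ≡bit true  = refl

chi≡χ : ∀ {n} (S : Vec Bool n) x → chi S x ≡ fromℤ (χ S x)
chi≡χ S x = sign (xorSum (toList (zipWith _∧_ S x)))
  where
  sign : ∀ b → (if b then ℚ.- 1ℚ else 1ℚ) ≡ fromℤ (sgn b)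
  sign false = refl
  sign true  = refl

twoPow-+ : ∀ a b → twoPow (a ℕ.+ b) ≡ twoPow a ℚ.* twoPow b
twoPow-+ zero    b = sym (ℚP.*-identityˡ (twoPow b))
twoPow-+ (suc a) b = trans (cong (fromℤ (+ 2) ℚ.*_) (twoPow-+ a b))
                           (sym (ℚP.*-assoc (fromℤ (+ 2)) (twoPow a) (twoPow b)))

fourier-numerator : ∀ {n} e (h : Cube n → ℚ) (hℤ : Cube n → ℤ) → (∀ x → h x ≡ fromℤ (hℤ x)) →
  ∀ S → fourier h S ℚ.* twoPow (e ℕ.+ n) ≡ fromℤ (cubeSum n (λ x → pow2 e * (hℤ x * χ S x)))
fourier-numerator {n} e h hℤ h≡ S = begin
  H ℚ.* X ℚ.* twoPow (e ℕ.+ n)                  ≡⟨ cong (H ℚ.* X ℚ.*_) (twoPow-+ e n) ⟩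
  H ℚ.* X ℚ.* (twoPow e ℚ.* twoPow n)           ≡⟨ regroup H X (twoPow e) (twoPow n) ⟩
  twoPow e ℚ.* X ℚ.* (H ℚ.* twoPow n)           ≡⟨ cong (twoPow e ℚ.* X ℚ.*_) (halfPow-inverse n) ⟩
  twoPow e ℚ.* X ℚ.* 1ℚ                         ≡⟨ ℚP.*-identityʳ _ ⟩
  twoPow e ℚ.* X                                ≡⟨ cong₂ ℚ._*_ (twoPow≡pow2 e) X≡N ⟩
  fromℤ (pow2 e) ℚ.* fromℤ N                    ≡⟨ fromℤ-* (pow2 e) N ⟩
  fromℤ (pow2 e * N)                            ≡⟨ cong fromℤ (Σ-scale (allPoints n) (pow2 e) _) ⟨
  fromℤ (cubeSum n (λ x → pow2 e * (hℤ x * χ S x))) ∎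
  where
  open ≡-Reasoning
  open +-*-Solver using (solve; _:*_; _:=_)
  H = halfPow n
  X = sumℚ (map (λ x → h x ℚ.* chi S x) (allPoints n))
  N = cubeSum n (λ x → hℤ x * χ S x)
  X≡N : X ≡ fromℤ N
  X≡N = sumℚ-fromℤ (allPoints n) _ _
          (λ x → trans (cong₂ ℚ._*_ (h≡ x) (chi≡χ S x)) (fromℤ-* (hℤ x) (χ S x)))
  regroup : ∀ a b c e → a ℚ.* b ℚ.* (c ℚ.* e) ≡ c ℚ.* b ℚ.* (a ℚ.* e)
  regroup = solve 4 (λ a b c e → a :* b :* (c :* e) := c :* b :* (a :* e)) refl

clear-denominator : ∀ {r N} m k M → r ≡ (m / 1) ℚ.* halfPow k → r ℚ.* twoPow M ≡ fromℤ N →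
                    N * pow2 k ≡ m * pow2 M
clear-denominator {r} {N} m k M r≡ rM≡N = fromℤ-injective (begin
  fromℤ (N * pow2 k)                                ≡⟨ fromℤ-* N (pow2 k) ⟨
  fromℤ N ℚ.* fromℤ (pow2 k)                        ≡⟨ cong₂ ℚ._*_ (sym rM≡N) (sym (twoPow≡pow2 k)) ⟩
  r ℚ.* twoPow M ℚ.* twoPow k                       ≡⟨ cong (λ z → z ℚ.* twoPow M ℚ.* twoPow k) r≡m2^-k ⟩
  fromℤ m ℚ.* halfPow k ℚ.* twoPow M ℚ.* twoPow k   ≡⟨ regroup (fromℤ m) (halfPow k) (twoPow M) (twoPow k) ⟩
  fromℤ m ℚ.* twoPow M ℚ.* (halfPow k ℚ.* twoPow k) ≡⟨ cong (fromℤ m ℚ.* twoPow M ℚ.*_) (halfPow-inverse k) ⟩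
  fromℤ m ℚ.* twoPow M ℚ.* 1ℚ                       ≡⟨ ℚP.*-identityʳ _ ⟩
  fromℤ m ℚ.* twoPow M                              ≡⟨ cong (fromℤ m ℚ.*_) (twoPow≡pow2 M) ⟩
  fromℤ m ℚ.* fromℤ (pow2 M)                        ≡⟨ fromℤ-* m (pow2 M) ⟩
  fromℤ (m * pow2 M)                                ∎)
  where
  open ≡-Reasoning
  open +-*-Solver using (solve; _:*_; _:=_)
  r≡m2^-k : r ≡ fromℤ m ℚ.* halfPow k
  r≡m2^-k = trans r≡ (cong (ℚ._* halfPow k) (fromℤ-/1 m))
  regroup : ∀ a b c e → a ℚ.* b ℚ.* c ℚ.* e ≡ a ℚ.* c ℚ.* (b ℚ.* e)
  regroup = solve 4 (λ a b c e → a :* b :* c :* e := a :* c :* (b :* e)) refl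

scale-integer : ∀ {r N} m k M → r ≡ (m / 1) ℚ.* twoPow (suc k) → r ℚ.* twoPow M ≡ fromℤ N →
                N ≡ m * pow2 (suc k ℕ.+ M)
scale-integer {r} {N} m k M r≡ rM≡N = fromℤ-injective (begin
  fromℤ N                                         ≡⟨ rM≡N ⟨
  r ℚ.* twoPow M                                  ≡⟨ cong (ℚ._* twoPow M) r≡m2^k ⟩
  fromℤ m ℚ.* fromℤ (pow2 (suc k)) ℚ.* twoPow M   ≡⟨ cong₂ ℚ._*_ (fromℤ-* m (pow2 (suc k))) (twoPow≡pow2 M) ⟩
  fromℤ (m * pow2 (suc k)) ℚ.* fromℤ (pow2 M)     ≡⟨ fromℤ-* (m * pow2 (suc k)) (pow2 M) ⟩
  fromℤ (m * pow2 (suc k) * pow2 M)               ≡⟨ cong fromℤ (ℤP.*-assoc m _ _) ⟩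
  fromℤ (m * (pow2 (suc k) * pow2 M))             ≡⟨ cong (λ z → fromℤ (m * z)) (pow2-+ (suc k) M) ⟨
  fromℤ (m * pow2 (suc k ℕ.+ M))                  ∎)
  where
  open ≡-Reasoning
  r≡m2^k : r ≡ fromℤ m ℚ.* fromℤ (pow2 (suc k))
  r≡m2^k = trans r≡ (cong₂ ℚ._*_ (fromℤ-/1 m) (twoPow≡pow2 (suc k)))

granularity-bound : ∀ {r K N} M j → GranIs r K → r ℚ.* twoPow M ≡ fromℤ N → pow2 j ∣ N → K ≤ + M - + j
granularity-bound {K = + k} M j (m , odd , r≡) rM≡N j∣N =
  subst (_≤ + M - + j) (cancel (+ j) (+ k))
    (ℤP.+-monoˡ-≤ (- + j) (ℤ.+≤+ (odd-pow2-bound (j ℕ.+ k) M odd j+k∣m2^M)))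
  where
  j+k∣m2^M : pow2 (j ℕ.+ k) ∣ m * pow2 M
  j+k∣m2^M = subst (pow2 (j ℕ.+ k) ∣_) (clear-denominator m k M r≡ rM≡N)
               (pow2-∣-* j k j∣N (divides 1ℤ (sym (ℤP.*-identityˡ (pow2 k)))))
  cancel : ∀ a b → a + b - a ≡ b
  cancel = solve-∀
granularity-bound {K = -[1+ k ]} M j (m , odd , r≡) rM≡N j∣N =
  subst (_≤ + M - + j) (cancel (+ suc k) (+ M))
    (ℤP.+-monoʳ-≤ (+ M) (ℤP.neg-mono-≤ (ℤ.+≤+ (odd-pow2-bound j (suc k ℕ.+ M) odd j∣m2^k+M))))
  where
  j∣m2^k+M : pow2 j ∣ m * pow2 (suc k ℕ.+ M)
  j∣m2^k+M = subst (pow2 j ∣_) (scale-integer m k M r≡ rM≡N) j∣N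
  cancel : ∀ a b → b - (a + b) ≡ - a
  cancel = solve-∀

floor-greatest : ∀ q i → i * ↧ q ≤ ↥ q → i ≤ floor q
floor-greatest (mkℚ num den-1 _) i i*D≤num =
  subst (i ≤_) (trans (ℤP.pred-suc q) (sym (div-pos-is-/ℕ num D))) (ℤP.i<j⇒i≤pred[j] i<q+1)
  where
  D = suc den-1
  q = num /ℕ D
  i<q+1 : i < ℤ.suc q
  i<q+1 = ℤP.*-cancelʳ-<-nonNeg (+ D) (ℤP.≤-<-trans i*D≤num (n<s[n/ℕd]*d num D))

ceiling-least : ∀ p j → ↥ p ≤ j * ↧ p → ceiling p ≤ j
ceiling-least p@record{} j p≤j =
  subst (- floor (ℚ.- p) ≤_) (ℤP.neg-involutive j)
    (ℤP.neg-mono-≤ (floor-greatest (ℚ.- p) (- j) -j≤-p))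
  where
  -j≤-p : - j * ↧ (ℚ.- p) ≤ ↥ (ℚ.- p)
  -j≤-p = subst₂ _≤_ (trans (ℤP.neg-distribˡ-* j (↧ p)) (cong (- j *_) (sym (ℚP.↧-neg p))))
                     (sym (ℚP.↥-neg p))
                     (ℤP.neg-mono-≤ p≤j)

ceiling-/-least : ∀ n d .{{_ : NonZero d}} j → n ℕ.≤ j ℕ.* d → ceiling (+ n / d) ≤ + j
ceiling-/-least n d j n≤jd = ceiling-least (+ n / d) (+ j)
  (ℤP.*-cancelʳ-≤-pos (↥ (+ n / d)) (+ j * ↧ (+ n / d)) g {{g-positive}} (begin
    ↥ (+ n / d) * g            ≡⟨ ℚP.↥-/ (+ n) d ⟩
    + n                        ≤⟨ ℤ.+≤+ n≤jd ⟩
    + (j ℕ.* d)                ≡⟨ ℤP.pos-* j d ⟩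
    + j * + d                  ≡⟨ cong (+ j *_) (ℚP.↧-/ (+ n) d) ⟨
    + j * (↧ (+ n / d) * g)    ≡⟨ ℤP.*-assoc (+ j) _ g ⟨
    + j * ↧ (+ n / d) * g      ∎))
  where
  open ℤP.≤-Reasoning
  g = + ℕGCD.gcd n d
  g-positive : ℤ.Positive g
  g-positive = ℤ.positive (ℤ.+<+ (ℕP.n≢0⇒n>0 (ℕGCD.gcd[m,n]≢0 n d (inj₂ (ℕ.≢-nonZero⁻¹ d)))))

module DegreeBound (d : ℕ) .{{_ : NonZero d}} where

  -- Div s a: 2^k divides a for some k with s ≤ k·d; for s ≥ 0 this says 2^⌈s/d⌉ ∣ a.
  Div : ℤ → ℤ → Set
  Div s a = Σ ℕ λ k → (s ≤ + (k ℕ.* d)) × pow2 k ∣ a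

  Div-mono : ∀ {s s′ a} → s′ ≤ s → Div s a → Div s′ a
  Div-mono s′≤s (k , s≤kd , k∣a) = k , ℤP.≤-trans s′≤s s≤kd , k∣a

  Div-zero : ∀ s → Div s 0ℤ
  Div-zero s = ℤ.∣ s ∣ , s≤∣s∣d s , divides 0ℤ refl
    where
    s≤∣s∣d : ∀ s → s ≤ + (ℤ.∣ s ∣ ℕ.* d)
    s≤∣s∣d (+ m)    = ℤ.+≤+ (ℕP.m≤m*n m d)
    s≤∣s∣d -[1+ m ] = ℤ.-≤+

  Div-one : Div 0ℤ 1ℤ
  Div-one = 0 , ℤ.+≤+ ℕ.z≤n , divides 1ℤ refl

  Div-two : Div (+ d) (+ 2)
  Div-two = 1 , ℤP.≤-reflexive (cong +_ (sym (ℕP.*-identityˡ d))) , divides 1ℤ refl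

  Div-+ : ∀ {s a b} → Div s a → Div s b → Div s (a + b)
  Div-+ (k , s≤kd , k∣a) (l , s≤ld , l∣b) with ℕP.≤-total k l
  ... | inj₁ k≤l = k , s≤kd , ∣m∣n⇒∣m+n k∣a (∣-trans (pow2-∣-mono k≤l) l∣b)
  ... | inj₂ l≤k = l , s≤ld , ∣m∣n⇒∣m+n (∣-trans (pow2-∣-mono l≤k) k∣a) l∣b

  Div-neg : ∀ {s a} → Div s a → Div s (- a)
  Div-neg (k , s≤kd , k∣a) = k , s≤kd , ∣m⇒∣-m k∣a

  Div-* : ∀ {s t a b} → Div s a → Div t b → Div (s + t) (a * b)
  Div-* {s} {t} (k , s≤kd , k∣a) (l , t≤ld , l∣b) = k ℕ.+ l , s+t≤[k+l]d , pow2-∣-* k l k∣a l∣b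
    where
    open ℤP.≤-Reasoning
    s+t≤[k+l]d : s + t ≤ + ((k ℕ.+ l) ℕ.* d)
    s+t≤[k+l]d = begin
      s + t                         ≤⟨ ℤP.+-mono-≤ s≤kd t≤ld ⟩
      + (k ℕ.* d) + + (l ℕ.* d)     ≡⟨ ℤP.pos-+ (k ℕ.* d) (l ℕ.* d) ⟨
      + (k ℕ.* d ℕ.+ l ℕ.* d)       ≡⟨ cong +_ (ℕP.*-distribʳ-+ d k l) ⟨
      + ((k ℕ.+ l) ℕ.* d)           ∎

  -- Graded n s h: writing h = Σ_D c_D x^D as a multilinear integer polynomial,
  -- every coefficient satisfies Div (s + |D|).
  Graded : (n : ℕ) → ℤ → (Cube n → ℤ) → Set
  Graded zero    s h = Div s (h [])
  Graded (suc n) s h = Graded n s (λ x → h (false ∷ x))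
                     × Graded n (s + 1ℤ) (λ x → h (true ∷ x) - h (false ∷ x))

  Graded-ext : ∀ n {s h h′} → (∀ x → h x ≡ h′ x) → Graded n s h → Graded n s h′
  Graded-ext zero    h≡h′ g         = subst (Div _) (h≡h′ []) g
  Graded-ext (suc n) h≡h′ (g₀ , g₁) =
    Graded-ext n (λ x → h≡h′ (false ∷ x)) g₀ ,
    Graded-ext n (λ x → cong₂ _-_ (h≡h′ (true ∷ x)) (h≡h′ (false ∷ x))) g₁

  Graded-mono : ∀ n {s s′ h} → s′ ≤ s → Graded n s h → Graded n s′ h
  Graded-mono zero    s′≤s g         = Div-mono s′≤s g
  Graded-mono (suc n) s′≤s (g₀ , g₁) = Graded-mono n s′≤s g₀ , Graded-mono n (ℤP.+-monoˡ-≤ 1ℤ s′≤s) g₁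

  Graded-zero : ∀ n s → Graded n s (λ _ → 0ℤ)
  Graded-zero zero    s = Div-zero s
  Graded-zero (suc n) s = Graded-zero n s , Graded-zero n (s + 1ℤ)

  Graded-const : ∀ n {s c} → Div s c → Graded n s (λ _ → c)
  Graded-const zero    c-div = c-div
  Graded-const (suc n) {s} {c} c-div =
    Graded-const n c-div , Graded-ext n (λ _ → sym (ℤP.+-inverseʳ c)) (Graded-zero n (s + 1ℤ))

  Graded-+ : ∀ n {s h h′} → Graded n s h → Graded n s h′ → Graded n s (λ x → h x + h′ x)
  Graded-+ zero    g g′ = Div-+ g g′
  Graded-+ (suc n) {h = h} {h′} (g₀ , g₁) (g₀′ , g₁′) =
    Graded-+ n g₀ g₀′ ,
    Graded-ext n (λ x → interchange (h (true ∷ x)) (h (false ∷ x)) (h′ (true ∷ x)) (h′ (false ∷ x)))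
      (Graded-+ n g₁ g₁′)
    where
    interchange : ∀ a b c e → (a - b) + (c - e) ≡ (a + c) - (b + e)
    interchange = solve-∀

  Graded-neg : ∀ n {s h} → Graded n s h → Graded n s (λ x → - h x)
  Graded-neg zero    g         = Div-neg g
  Graded-neg (suc n) {h = h} (g₀ , g₁) =
    Graded-neg n g₀ , Graded-ext n (λ x → negate (h (true ∷ x)) (h (false ∷ x))) (Graded-neg n g₁)
    where
    negate : ∀ a b → - (a - b) ≡ - a - - b
    negate = solve-∀

  -- Levels add under multiplication, by the Leibniz rule
  --   Δ(h·h′) = Δh·Δh′ + Δh·h′₀ + h₀·Δh′.
  Graded-* : ∀ n {s t h h′} → Graded n s h → Graded n t h′ → Graded n (s + t) (λ x → h x * h′ x)
  Graded-* zero    g g′ = Div-* g g′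
  Graded-* (suc n) {s} {t} {h} {h′} (g₀ , g₁) (g₀′ , g₁′) =
    Graded-* n g₀ g₀′ ,
    Graded-ext n (λ x → leibniz (h (true ∷ x)) (h (false ∷ x)) (h′ (true ∷ x)) (h′ (false ∷ x)))
      (Graded-+ n (Graded-+ n (Graded-mono n ΔΔ (Graded-* n g₁ g₁′))
                              (Graded-mono n Δ₀ (Graded-* n g₁ g₀′)))
                  (Graded-mono n ₀Δ (Graded-* n g₀ g₁′)))
    where
    leibniz : ∀ p q r u → (p - q) * (r - u) + (p - q) * u + q * (r - u) ≡ p * r - q * u
    leibniz = solve-∀
    ΔΔ : s + t + 1ℤ ≤ s + 1ℤ + (t + 1ℤ)
    ΔΔ = ℤP.≤-trans (ℤP.i≤j⇒i≤1+j ℤP.≤-refl) (ℤP.≤-reflexive (shift s t))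
      where
      shift : ∀ s t → 1ℤ + (s + t + 1ℤ) ≡ s + 1ℤ + (t + 1ℤ)
      shift = solve-∀
    Δ₀ : s + t + 1ℤ ≤ s + 1ℤ + t
    Δ₀ = ℤP.≤-reflexive (shift s t)
      where
      shift : ∀ s t → s + t + 1ℤ ≡ s + 1ℤ + t
      shift = solve-∀
    ₀Δ : s + t + 1ℤ ≤ s + (t + 1ℤ)
    ₀Δ = ℤP.≤-reflexive (ℤP.+-assoc s t 1ℤ)

  -- Summing over the cube raises the level by n, since Σ_x x^D = 2^{n-|D|}:
  -- Σ h = Σ (h₁ - h₀) + 2·Σ h₀ and d ≥ 1.
  Graded-sum : ∀ n {s h} → Graded n s h → Div (+ n + s) (cubeSum n h)
  Graded-sum zero    {s} {h} g = subst₂ Div (sym (ℤP.+-identityˡ s)) (sym (ℤP.+-identityʳ (h []))) g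
  Graded-sum (suc n) {s} {h} (g₀ , g₁) =
    subst (Div _) (sym split)
      (Div-+ (Div-mono (ℤP.≤-reflexive diff-level) (Graded-sum n g₁))
             (Div-mono double-level (Div-* Div-two (Graded-sum n g₀))))
    where
    open ≡-Reasoning
    Σ₀ = cubeSum n (λ x → h (false ∷ x))
    Σ₁ = cubeSum n (λ x → h (true ∷ x))
    rearrange : ∀ a b → a + b ≡ (b - a) + + 2 * a
    rearrange = solve-∀
    split : cubeSum (suc n) h ≡ cubeSum n (λ x → h (true ∷ x) - h (false ∷ x)) + + 2 * Σ₀
    split = begin
      cubeSum (suc n) h      ≡⟨ cubeSum-suc n h ⟩
      Σ₀ + Σ₁                ≡⟨ rearrange Σ₀ Σ₁ ⟩
      (Σ₁ - Σ₀) + + 2 * Σ₀   ≡⟨ cong (_+ + 2 * Σ₀) (Σ-sub (allPoints n) _ _) ⟨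
      cubeSum n (λ x → h (true ∷ x) - h (false ∷ x)) + + 2 * Σ₀ ∎
    diff-level : + suc n + s ≡ + n + (s + 1ℤ)
    diff-level = shift (+ n) s
      where
      shift : ∀ m s → 1ℤ + m + s ≡ m + (s + 1ℤ)
      shift = solve-∀
    double-level : + suc n + s ≤ + d + (+ n + s)
    double-level = ℤP.≤-trans (ℤP.≤-reflexive (ℤP.+-assoc 1ℤ (+ n) s))
                              (ℤP.+-monoˡ-≤ (+ n + s) (ℤ.+≤+ (ℕ.>-nonZero⁻¹ d)))

  -- Characters are graded at level 0: in direction i ∈ S the difference is -2·χ.
  χ-graded : ∀ n (S : Vec Bool n) → Graded n 0ℤ (χ S)
  χ-graded zero    []          = Div-one
  χ-graded (suc n) (false ∷ S) =
    χ-graded n S , Graded-ext n (λ x → sym (ℤP.+-inverseʳ (χ S x))) (Graded-zero n 1ℤ)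
  χ-graded (suc n) (true ∷ S)  =
    χ-graded n S ,
    Graded-ext n (λ x → sym (sgn-not (xorSum (toList (zipWith _∧_ S x)))))
      (Graded-mono n 1≤d+0 (Graded-neg n (Graded-* n (Graded-const n Div-two) (χ-graded n S))))
    where
    1≤d+0 : 1ℤ ≤ + d + 0ℤ
    1≤d+0 = ℤP.≤-trans (ℤ.+≤+ (ℕ.>-nonZero⁻¹ d)) (ℤP.≤-reflexive (sym (ℤP.+-identityʳ (+ d))))

  -- The monomial x^T is its own expansion: its single coefficient sits at D = T.
  monomial-graded : ∀ n (T : Vec Bool n) → Graded n (- + card T) (monomial T)
  monomial-graded zero    []          = Div-one
  monomial-graded (suc n) (false ∷ T) =
    monomial-graded n T , Graded-ext n (λ x → sym (ℤP.+-inverseʳ (monomial T x))) (Graded-zero n _)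
  monomial-graded (suc n) (true ∷ T)  =
    Graded-zero n _ ,
    Graded-ext n (λ x → sym (ℤP.+-identityʳ (monomial T x)))
      (Graded-mono n (ℤP.≤-reflexive level) (monomial-graded n T))
    where
    shift : ∀ c → - (1ℤ + c) + 1ℤ ≡ - c
    shift = solve-∀
    level : - + suc (card T) + 1ℤ ≡ - + card T
    level = trans (cong (λ z → - z + 1ℤ) (ℤP.pos-+ 1 (card T))) (shift (+ card T))

  anf-term-graded : ∀ n (a : Cube n → Bool) T → (a T ≡ true → card T ℕ.≤ d) →
                    Graded n 0ℤ (λ x → sgn (a T ∧ (T ⊆ᵇ x)))
  anf-term-graded n a T deg with a T
  ... | false = Graded-const n Div-one
  ... | true  = Graded-ext n (λ x → sym (sgn-bit (T ⊆ᵇ x)))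
                  (Graded-+ n (Graded-const n Div-one) (Graded-mono n 0≤d-|T| (Graded-neg n minus-part)))
    where
    minus-part : Graded n (+ d - + card T) (λ x → + 2 * monomial T x)
    minus-part = Graded-* n (Graded-const n Div-two) (monomial-graded n T)
    0≤d-|T| : 0ℤ ≤ + d - + card T
    0≤d-|T| = ℤP.i≤j⇒0≤j-i (ℤ.+≤+ (deg refl))

  anf-sign-graded : ∀ n (a : Cube n → Bool) → (∀ T → a T ≡ true → card T ℕ.≤ d) → ∀ L →
                    Graded n 0ℤ (λ x → sgn (xorSum (map (λ T → a T ∧ (T ⊆ᵇ x)) L)))
  anf-sign-graded n a deg []      = Graded-const n Div-one
  anf-sign-graded n a deg (T ∷ L) =
    Graded-ext n (λ x → sym (sgn-xor (a T ∧ (T ⊆ᵇ x)) _))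
      (Graded-* n (anf-term-graded n a T (deg T)) (anf-sign-graded n a deg L))

  fourier-granularity : ∀ n e (h : Cube n → ℚ) (hℤ : Cube n → ℤ) → (∀ x → h x ≡ fromℤ (hℤ x)) →
    (∀ S → Graded n 0ℤ (λ x → pow2 e * (hℤ x * χ S x))) →
    ∀ g → FourierGranIs h g → g ≤ + (e ℕ.+ n) - ceiling (+ n / d)
  fourier-granularity n e h hℤ h≡ graded g ((S , _ , gran) , _) with Graded-sum n (graded S)
  ... | j , n≤jd , j∣sum =
    ℤP.≤-trans (granularity-bound (e ℕ.+ n) j gran (fourier-numerator e h hℤ h≡ S) j∣sum)
               (ℤP.+-monoʳ-≤ (+ (e ℕ.+ n)) (ℤP.neg-mono-≤ (ceiling-/-least n d j n≤jd′)))
    where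
    n≤jd′ : n ℕ.≤ j ℕ.* d
    n≤jd′ = ℤP.drop‿+≤+ (subst (_≤ + (j ℕ.* d)) (ℤP.+-identityʳ (+ n)) n≤jd)

theorem6p3 : (n : ℕ) (f : Cube n → Bool) (d : ℕ) .{{_ : NonZero d}} →
    NonConstant f → IsDeg2 f d →
    ((g : ℤ) → FourierGranIs (pm f) g → g ≤ + n - ceiling (+ n / d))
    × ((g : ℤ) → FourierGranIs (λ x → toℚ (f x)) g → g ≤ + n - ceiling (+ n / d) + + 1)
theorem6p3 n f d _ (a , f≡anf , _ , deg≤d) = pm-bound , f-bound
  where
  open DegreeBound d

  sign-graded : Graded n 0ℤ (λ x → sgn (f x))
  sign-graded = Graded-ext n (λ x → cong sgn (sym (f≡anf x))) (anf-sign-graded n a deg≤d (allPoints n))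

  sign-χ-graded : ∀ S → Graded n 0ℤ (λ x → sgn (f x) * χ S x)
  sign-χ-graded S = Graded-* n sign-graded (χ-graded n S)

  pm-bound : (g : ℤ) → FourierGranIs (pm f) g → g ≤ + n - ceiling (+ n / d)
  pm-bound = fourier-granularity n 0 (pm f) (λ x → sgn (f x)) (λ x → pm≡sgn (f x))
    (λ S → Graded-ext n (λ x → sym (ℤP.*-identityˡ _)) (sign-χ-graded S))

  f-bound : (g : ℤ) → FourierGranIs (λ x → toℚ (f x)) g → g ≤ + n - ceiling (+ n / d) + + 1
  f-bound g gran = subst (g ≤_) (reorder (+ n) (ceiling (+ n / d)))
    (fourier-granularity n 1 (λ x → toℚ (f x)) (λ x → bit (f x)) (λ x → toℚ≡bit (f x))
      bit-χ-graded g gran)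
    where
    bit-χ-graded : ∀ S → Graded n 0ℤ (λ x → + 2 * (bit (f x) * χ S x))
    bit-χ-graded S = Graded-ext n (λ x → sym (two-bit (f x) (χ S x)))
                       (Graded-+ n (χ-graded n S) (Graded-neg n (sign-χ-graded S)))
    reorder : ∀ a c → 1ℤ + a - c ≡ a - c + + 1
    reorder = solve-∀
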